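{- For all integers $k\ge 1$ and $b\ge 2$, there exists a factored graph representation of complexity $(b,k^2)$ for the increasing path $\vec{\pi}_{b^k}:=([0]_b^k,[1]_b^k,\dots,[b^k-1]_b^k)$, i.e., the directed graph with vertex set $\mathbb{Z}_b^k$ and edges $([j]_b^k,[j+1]_b^k)$ for $0\le j<b^k-1$.
   Context: All graphs are directed. Graph operations: Cartesian product $G\,\square\,H$ (vertex set $V(G)\times V(H)$, edge $((v_1,u_1),(v_2,u_2))$ iff $v_1=v_2$ and $(u_1,u_2)\in E(H)$, or $u_1=u_2$ and $(v_1,v_2)\in E(G)$), tensor product $G\times H$ (vertex set $V(G)\times V(H)$, edge iff $(v_1,v_2)\in E(G)$ and $(u_1,u_2)\in E(H)$), and union $G\cup H$ (vertex set $V(G)\cup V(H)$, edge set $E(G)\cup E(H)$). Vertices of products are flattened tuples, so products are associative. A factored graph representation is a formula built from input graphs using these operations and parentheses; it has complexity $(n,k)$ if it uses $k-1$ operations on input graphs with at most $n$ vertices each. For $0\le j\le b^k-1$, $[j]_b^k=(b_{k-1},\dots,b_1,b_0)\in\mathbb{Z}_b^k$ denotes the $k$-digit base-$b$ expansion of $j$, i.e. $j=\sum_{i=0}^{k-1}b_ib^i$. -}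

module Defs where

open import Data.Nat using (ℕ; zero; suc; _+_; _*_; _^_; _≤_; _<_)
open import Data.Nat.DivMod using (_/_; _%_)
open import Data.List using (List; []; _∷_; _++_; [_]; length)
open import Data.List.Relation.Unary.All using (All)
open import Data.List.Relation.Unary.Unique.Propositional using (Unique)
open import Data.List.Membership.Propositional using (_∈_)
open import Data.Product using (Σ; ∃; ∃-syntax; _×_; _,_; proj₁; proj₂)
open import Data.Sum using (_⊎_)
open import Relation.Binary.PropositionalEquality using (_≡_)
open import Function.Bundles using (_⇔_)

-- Vertices are flattened tuples, represented as lists of natural numbers
-- (atoms).  Flattening of product vertices is list concatenation, so the
-- products are associative on vertices.
Vertex : Set
Vertex = List ℕ

record Graph : Set₁ where
  field
    V : Vertex → Set
    E : Vertex → Vertex → Set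

open Graph public

record _≅_ (G H : Graph) : Set where
  field
    vert : ∀ v → V G v ⇔ V H v
    edge : ∀ u w → E G u w ⇔ E H u w

record InputGraph : Set where
  field
    verts  : List ℕ
    unique : Unique verts
    edges  : List (ℕ × ℕ)
    closed : All (λ e → (proj₁ e ∈ verts) × (proj₂ e ∈ verts)) edges

open InputGraph public

size : InputGraph → ℕ
size G = length (verts G)

inputGraph : InputGraph → Graph
V (inputGraph G) v = ∃[ a ] (v ≡ [ a ] × a ∈ verts G)
E (inputGraph G) u w = ∃[ a ] ∃[ c ] (u ≡ [ a ] × w ≡ [ c ] × (a , c) ∈ edges G)

_□_ : Graph → Graph → Graph
V (G □ H) v = ∃[ x ] ∃[ y ] (v ≡ x ++ y × V G x × V H y)
E (G □ H) u w = ∃[ x₁ ] ∃[ y₁ ] ∃[ x₂ ] ∃[ y₂ ]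
  (u ≡ x₁ ++ y₁ × w ≡ x₂ ++ y₂ ×
    ((x₁ ≡ x₂ × V G x₁ × E H y₁ y₂) ⊎ (y₁ ≡ y₂ × V H y₁ × E G x₁ x₂)))

_⊗_ : Graph → Graph → Graph
V (G ⊗ H) v = ∃[ x ] ∃[ y ] (v ≡ x ++ y × V G x × V H y)
E (G ⊗ H) u w = ∃[ x₁ ] ∃[ y₁ ] ∃[ x₂ ] ∃[ y₂ ]
  (u ≡ x₁ ++ y₁ × w ≡ x₂ ++ y₂ × E G x₁ x₂ × E H y₁ y₂)

_∪_ : Graph → Graph → Graph
V (G ∪ H) v = V G v ⊎ V H v
E (G ∪ H) u w = E G u w ⊎ E H u w

-- Factored graph representations: formulas over input graphs.
data Formula : Set where
  leaf : InputGraph → Formula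
  cart tensor union : Formula → Formula → Formula

⟦_⟧ : Formula → Graph
⟦ leaf G ⟧ = inputGraph G
⟦ cart f g ⟧ = ⟦ f ⟧ □ ⟦ g ⟧
⟦ tensor f g ⟧ = ⟦ f ⟧ ⊗ ⟦ g ⟧
⟦ union f g ⟧ = ⟦ f ⟧ ∪ ⟦ g ⟧

-- Number of input-graph occurrences (leaves); a formula with k leaves
-- uses exactly k - 1 (binary) operations.
leaves : Formula → ℕ
leaves (leaf _) = 1
leaves (cart f g) = leaves f + leaves g
leaves (tensor f g) = leaves f + leaves g
leaves (union f g) = leaves f + leaves g

AllInputsAtMost : ℕ → Formula → Set
AllInputsAtMost n (leaf G) = size G ≤ n
AllInputsAtMost n (cart f g) = AllInputsAtMost n f × AllInputsAtMost n g
AllInputsAtMost n (tensor f g) = AllInputsAtMost n f × AllInputsAtMost n g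
AllInputsAtMost n (union f g) = AllInputsAtMost n f × AllInputsAtMost n g

-- Complexity (n , k): k - 1 operations (i.e. k leaves), inputs of ≤ n vertices.
HasComplexity : ℕ → ℕ → Formula → Set
HasComplexity n k f = leaves f ≡ k × AllInputsAtMost n f

-- k-digit base-b expansion [j]_b^k = (b_{k-1}, …, b_0), most significant
-- digit first.  (The b = 0 clause is junk; only b ≥ 2 is used.)
digits : ℕ → ℕ → ℕ → List ℕ
digits b zero j = []
digits zero (suc k) j = []
digits (suc b) (suc k) j = digits (suc b) k (j / suc b) ++ [ j % suc b ]

incPath : ℕ → ℕ → Graph
V (incPath b k) v = length v ≡ k × All (_< b) v
E (incPath b k) u w = ∃[ j ] (suc j < b ^ k × u ≡ digits b k j × w ≡ digits b k (suc j))

{-# OPTIONS --safe #-}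
module Submission where

-- Write a number below b^(K+1) as r + q·b with last digit r < b. Its successor either
-- increments r < b − 1 and keeps the leading digits q, or, when r = b − 1, resets the last
-- digit to 0 and replaces q by its successor. So the increasing path on Z_b^(K+1) is
-- (π_{b^K} ⊗ C) ∪ (I_K ⊗ P), where P is the path 0 → 1 → ⋯ → b − 1 on Z_b, C is the single
-- edge b − 1 → 0, and I_K is the graph with a loop at every vertex of Z_b^K, a tensor power
-- of I_1. Induction on K, starting from π_b = P, yields the formula.

open import Defs
open import Data.Nat using (ℕ; zero; suc; _+_; _*_; _^_; _≤_; _<_; _≟_; s≤s; s≤s⁻¹; z<s)
open import Data.Nat.Properties
open import Data.Nat.DivMod using (_/_; _%_; m≡m%n+[m/n]*n; [m+kn]%n≡m%n; +-distrib-/; m%n<n; m<n⇒m%n≡m; m<n⇒m/n≡0; m*n%n≡0; m*n/n≡m)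
open import Data.Nat.Solver using (module +-*-Solver)
open import Data.List using ([]; _∷_; _++_; [_]; length; upTo; filter; cartesianProduct)
open import Data.List.Properties using (length-++; length-upTo)
open import Data.List.Relation.Unary.All as All using (All; []; _∷_)
open import Data.List.Relation.Unary.All.Properties using (++⁺)
open import Data.List.Membership.Propositional.Properties
  using (∈-upTo⁺; ∈-upTo⁻; ∈-filter⁺; ∈-filter⁻; ∈-cartesianProduct⁺; ∈-cartesianProduct⁻)
open import Data.List.Relation.Unary.Unique.Propositional.Properties using (upTo⁺)
open import Data.Product using (∃; ∃₂; ∃-syntax; _×_; _,_; proj₁; proj₂)
open import Data.Sum using (_⊎_; inj₁; inj₂; [_,_]′; reduce)
import Data.Sum as Sum
open import Data.Sum.Function.Propositional using (_⊎-⇔_)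
open import Function using (_∘_)
open import Function.Bundles using (_⇔_; mk⇔; Equivalence)
open import Function.Properties.Equivalence using () renaming (refl to ⇔-refl; sym to ⇔-sym; trans to ⇔-trans)
open import Relation.Binary.PropositionalEquality using (_≡_; refl; sym; trans; cong; cong₂; subst; subst₂; module ≡-Reasoning)
open import Relation.Nullary.Decidable using (Dec; _×-dec_)

open Equivalence using (to; from)
open _≅_
open +-*-Solver using (solve; _:+_; _:*_; _:^_; con; _:=_)

-- Z_b^k; definitionally the vertex set of incPath b k.
Tuple : ℕ → ℕ → Vertex → Set
Tuple b k v = length v ≡ k × All (_< b) v

module _ {b : ℕ} where

  Tuple-++⁺ : ∀ {m n x y} → Tuple b m x → Tuple b n y → Tuple b (m + n) (x ++ y)
  Tuple-++⁺ {x = x} (refl , ax) (refl , ay) = length-++ x , ++⁺ ax ay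

  Tuple-++⁻ : ∀ m {n} v → Tuple b (m + n) v →
              ∃₂ λ x y → v ≡ x ++ y × Tuple b m x × Tuple b n y
  Tuple-++⁻ zero v t = [] , v , refl , (refl , []) , t
  Tuple-++⁻ (suc m) [] (() , _)
  Tuple-++⁻ (suc m) (a ∷ v) (l , a<b ∷ av) with Tuple-++⁻ m v (suc-injective l , av)
  ... | x , y , refl , (lx , ax) , ty = a ∷ x , y , refl , (cong suc lx , a<b ∷ ax) , ty

  Tuple-[_] : ∀ {a} → a < b → Tuple b 1 [ a ]
  Tuple-[ a<b ] = refl , a<b ∷ []

  Tuple-[]⁻ : ∀ {v} → Tuple b 1 v → ∃ λ a → v ≡ [ a ] × a < b
  Tuple-[]⁻ {a ∷ []} (refl , a<b ∷ []) = a , refl , a<b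

record _⊆_ (G H : Graph) : Set where
  field
    vert : ∀ {v} → V G v → V H v
    edge : ∀ {u w} → E G u w → E H u w

module ⊆ = _⊆_

module _ {G H : Graph} where

  ⊆-antisym : G ⊆ H → H ⊆ G → G ≅ H
  ⊆-antisym p q = record
    { vert = λ _ → mk⇔ (⊆.vert p) (⊆.vert q)
    ; edge = λ _ _ → mk⇔ (⊆.edge p) (⊆.edge q)
    }

  ≅⇒⊆ : G ≅ H → G ⊆ H
  ≅⇒⊆ p = record { vert = to (vert p _) ; edge = to (edge p _ _) }

  ≅⇒⊇ : G ≅ H → H ⊆ G
  ≅⇒⊇ p = record { vert = from (vert p _) ; edge = from (edge p _ _) }

≅-trans : ∀ {G H K} → G ≅ H → H ≅ K → G ≅ K
≅-trans p q = record
  { vert = λ v → ⇔-trans (vert p v) (vert q v)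
  ; edge = λ u w → ⇔-trans (edge p u w) (edge q u w)
  }

module _ {G G′ H H′ : Graph} where

  ⊗-mono : G ⊆ G′ → H ⊆ H′ → (G ⊗ H) ⊆ (G′ ⊗ H′)
  ⊗-mono p q = record
    { vert = λ (x , y , e , gx , hy) → x , y , e , ⊆.vert p gx , ⊆.vert q hy
    ; edge = λ (x₁ , y₁ , x₂ , y₂ , e₁ , e₂ , g , h) → x₁ , y₁ , x₂ , y₂ , e₁ , e₂ , ⊆.edge p g , ⊆.edge q h
    }

  ∪-mono : G ⊆ G′ → H ⊆ H′ → (G ∪ H) ⊆ (G′ ∪ H′)
  ∪-mono p q = record { vert = Sum.map (⊆.vert p) (⊆.vert q) ; edge = Sum.map (⊆.edge p) (⊆.edge q) }

⊗-cong : ∀ {G G′ H H′} → G ≅ G′ → H ≅ H′ → (G ⊗ H) ≅ (G′ ⊗ H′)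
⊗-cong p q = ⊆-antisym (⊗-mono (≅⇒⊆ p) (≅⇒⊆ q)) (⊗-mono (≅⇒⊇ p) (≅⇒⊇ q))

∪-cong : ∀ {G G′ H H′} → G ≅ G′ → H ≅ H′ → (G ∪ H) ≅ (G′ ∪ H′)
∪-cong p q = ⊆-antisym (∪-mono (≅⇒⊆ p) (≅⇒⊆ q)) (∪-mono (≅⇒⊇ p) (≅⇒⊇ q))

∪-idem : ∀ {G} → (G ∪ G) ≅ G
∪-idem = ⊆-antisym (record { vert = reduce ; edge = reduce }) (record { vert = inj₁ ; edge = inj₁ })

OnTuples : ℕ → ℕ → Graph → Set
OnTuples b k G = ∀ v → V G v ⇔ Tuple b k v

module _ {b : ℕ} where

  ⊗-onTuples : ∀ {m n G H} → OnTuples b m G → OnTuples b n H → OnTuples b (m + n) (G ⊗ H)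
  ⊗-onTuples {m} g h v = mk⇔
    (λ { (x , y , refl , gx , hy) → Tuple-++⁺ (to (g x) gx) (to (h y) hy) })
    (λ t → let (x , y , v≡xy , tx , ty) = Tuple-++⁻ m v t in x , y , v≡xy , from (g x) tx , from (h y) ty)

  ∪-onTuples : ∀ {k G H} → OnTuples b k G → OnTuples b k H → OnTuples b k (G ∪ H)
  ∪-onTuples g h v = mk⇔ [ to (g v) , to (h v) ]′ (inj₁ ∘ from (g v))

  onTuples-≅ : ∀ {k G H} → OnTuples b k G → OnTuples b k H → (∀ u w → E G u w ⇔ E H u w) → G ≅ H
  onTuples-≅ g h e = record { vert = λ v → ⇔-trans (g v) (⇔-sym (h v)) ; edge = e }

diagonal : ℕ → ℕ → Graph
V (diagonal b k) = Tuple b k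
E (diagonal b k) u w = u ≡ w × Tuple b k u

diagonal-⊗ : ∀ {b m n} → (diagonal b m ⊗ diagonal b n) ≅ diagonal b (m + n)
diagonal-⊗ {b} {m} {n} = onTuples-≅ onTuples (λ _ → ⇔-refl) λ u w → mk⇔
  (λ { (_ , _ , _ , _ , refl , refl , (refl , tx) , (refl , ty)) → refl , Tuple-++⁺ tx ty })
  (λ { (refl , t) → let (x , y , u≡xy , tx , ty) = Tuple-++⁻ m u t
                     in x , y , x , y , u≡xy , u≡xy , (refl , tx) , (refl , ty) })
  where
  onTuples : OnTuples b (m + n) (diagonal b m ⊗ diagonal b n)
  onTuples = ⊗-onTuples {G = diagonal b m} {diagonal b n} (λ _ → ⇔-refl) (λ _ → ⇔-refl)

digitGraph : ℕ → (ℕ → ℕ → Set) → Graph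
V (digitGraph b R) = Tuple b 1
E (digitGraph b R) u w = ∃₂ λ a c → u ≡ [ a ] × w ≡ [ c ] × a < b × c < b × R a c

digitGraph-≡ : ∀ {b} → digitGraph b _≡_ ≅ diagonal b 1
digitGraph-≡ = onTuples-≅ (λ _ → ⇔-refl) (λ _ → ⇔-refl) λ u w → mk⇔
  (λ { (_ , _ , refl , refl , a<b , _ , refl) → refl , Tuple-[ a<b ] })
  (λ { (refl , t) → let (a , u≡a , a<b) = Tuple-[]⁻ t in a , a , u≡a , u≡a , a<b , a<b , refl })

module _ (b : ℕ) {R : ℕ → ℕ → Set} (R? : ∀ a c → Dec (R a c)) where

  private
    R?′ : ∀ ac → Dec (R (proj₁ ac) (proj₂ ac))
    R?′ (a , c) = R? a c

  digitInput : InputGraph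
  digitInput = record
    { verts  = upTo b
    ; unique = upTo⁺ b
    ; edges  = filter R?′ (cartesianProduct (upTo b) (upTo b))
    ; closed = All.tabulate λ e∈ → ∈-cartesianProduct⁻ (upTo b) (upTo b) (proj₁ (∈-filter⁻ R?′ e∈))
    }

  size-digitInput : size digitInput ≤ b
  size-digitInput = ≤-reflexive (length-upTo b)

  inputGraph-digitInput : inputGraph digitInput ≅ digitGraph b R
  inputGraph-digitInput = record
    { vert = λ v → mk⇔
        (λ { (a , refl , a∈) → Tuple-[ ∈-upTo⁻ a∈ ] })
        (λ t → let (a , v≡a , a<b) = Tuple-[]⁻ t in a , v≡a , ∈-upTo⁺ a<b)
    ; edge = λ u w → mk⇔
        (λ { (a , c , u≡a , w≡c , ac∈) →
               let (ac∈′ , r) = ∈-filter⁻ R?′ ac∈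
                   (a∈ , c∈) = ∈-cartesianProduct⁻ (upTo b) (upTo b) ac∈′
               in a , c , u≡a , w≡c , ∈-upTo⁻ a∈ , ∈-upTo⁻ c∈ , r })
        (λ { (a , c , u≡a , w≡c , a<b , c<b , r) →
               a , c , u≡a , w≡c , ∈-filter⁺ R?′ (∈-cartesianProduct⁺ (∈-upTo⁺ a<b) (∈-upTo⁺ c<b)) r })
    }

-- The base is b = suc m, so that digits b computes; m is the largest digit.
module Base (m : ℕ) where

  b : ℕ
  b = suc m

  [r+qb]%b≡r : ∀ {r} q → r < b → (r + q * b) % b ≡ r
  [r+qb]%b≡r {r} q r<b = trans ([m+kn]%n≡m%n r q b) (m<n⇒m%n≡m r<b)

  [r+qb]/b≡q : ∀ {r} q → r < b → (r + q * b) / b ≡ q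
  [r+qb]/b≡q {r} q r<b = trans (+-distrib-/ r (q * b) no-carry) (cong₂ _+_ (m<n⇒m/n≡0 r<b) (m*n/n≡m q b))
    where
    no-carry : r % b + (q * b) % b < b
    no-carry = subst (_< b) (sym (trans (cong₂ _+_ (m<n⇒m%n≡m r<b) (m*n%n≡0 q b)) (+-identityʳ r))) r<b

  digits-snoc : ∀ k {q r} → r < b → digits b (suc k) (r + q * b) ≡ digits b k q ++ [ r ]
  digits-snoc k {q} r<b = cong₂ (λ q′ r′ → digits b k q′ ++ [ r′ ]) ([r+qb]/b≡q q r<b) ([r+qb]%b≡r q r<b)

  snoc-bound : ∀ k {q r} → r < b → q < b ^ k → r + q * b < b ^ suc k
  snoc-bound k {q} r<b q<bᵏ = <-≤-trans (+-monoˡ-< (q * b) r<b)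
    (≤-trans (*-monoˡ-≤ b q<bᵏ) (≤-reflexive (*-comm (b ^ k) b)))

  digits-tuple : ∀ k j → Tuple b k (digits b k j)
  digits-tuple zero j = refl , []
  digits-tuple (suc k) j = subst (λ n → Tuple b n (digits b (suc k) j)) (+-comm k 1)
    (Tuple-++⁺ (digits-tuple k (j / b)) Tuple-[ m%n<n j b ])

  digits-surjective : ∀ k {x} → Tuple b k x → ∃ λ q → q < b ^ k × digits b k q ≡ x
  digits-surjective zero {[]} _ = 0 , z<s , refl
  digits-surjective (suc k) {x} t with Tuple-++⁻ k x (subst (λ n → Tuple b n x) (+-comm 1 k) t)
  ... | xs , y , refl , txs , ty with Tuple-[]⁻ ty | digits-surjective k txs
  ... | d , refl , d<b | q , q<bᵏ , refl = d + q * b , snoc-bound k d<b q<bᵏ , digits-snoc k d<b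

  Carry : ℕ → Vertex → Vertex → Set
  Carry K u w = ∃₂ λ x y → E (incPath b K) x y × u ≡ x ++ [ m ] × w ≡ y ++ [ 0 ]

  IncrementLast : ℕ → Vertex → Vertex → Set
  IncrementLast K u w = ∃₂ λ x r → Tuple b K x × r < m × u ≡ x ++ [ r ] × w ≡ x ++ [ suc r ]

  incPath-suc-edge⁻ : ∀ K {u w} → E (incPath b (suc K)) u w → Carry K u w ⊎ IncrementLast K u w
  incPath-suc-edge⁻ K (j , 1+j<bᴷ⁺¹ , refl , refl) with m<1+n⇒m<n∨m≡n (m%n<n j b)
  ... | inj₁ r<m = inj₂ (digits b K q , j % b , digits-tuple K q , r<m , refl , w≡)
    where
    q = j / b
    w≡ : digits b (suc K) (suc j) ≡ digits b K q ++ [ suc (j % b) ]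
    w≡ = trans (cong (digits b (suc K) ∘ suc) (m≡m%n+[m/n]*n j b)) (digits-snoc K (s≤s r<m))
  ... | inj₂ r≡m = inj₁ (digits b K q , digits b K (suc q) , (q , 1+q<bᴷ , refl , refl)
                         , cong (λ d → digits b K q ++ [ d ]) r≡m , w≡)
    where
    q = j / b
    1+j≡[1+q]b : suc j ≡ suc q * b
    1+j≡[1+q]b = cong suc (trans (m≡m%n+[m/n]*n j b) (cong (_+ q * b) r≡m))
    1+q<bᴷ : suc q < b ^ K
    1+q<bᴷ = *-cancelʳ-< b (suc q) (b ^ K) (subst₂ _<_ 1+j≡[1+q]b (*-comm b (b ^ K)) 1+j<bᴷ⁺¹)
    w≡ : digits b (suc K) (suc j) ≡ digits b K (suc q) ++ [ 0 ]
    w≡ = trans (cong (digits b (suc K)) 1+j≡[1+q]b) (digits-snoc K z<s)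

  incPath-suc-edge⁺ : ∀ K {u w} → Carry K u w ⊎ IncrementLast K u w → E (incPath b (suc K)) u w
  incPath-suc-edge⁺ K (inj₁ (_ , _ , (q , 1+q<bᴷ , refl , refl) , refl , refl)) =
    m + q * b , snoc-bound K z<s 1+q<bᴷ , sym (digits-snoc K ≤-refl) , sym (digits-snoc K z<s)
  incPath-suc-edge⁺ K (inj₂ (_ , r , tx , r<m , refl , refl)) with digits-surjective K tx
  ... | q , q<bᴷ , refl =
    r + q * b , snoc-bound K (s≤s r<m) q<bᴷ
              , sym (digits-snoc K (m<n⇒m<1+n r<m)) , sym (digits-snoc K (s≤s r<m))

  carryDigit succDigit : Graph
  carryDigit = digitGraph b (λ a c → a ≡ m × c ≡ 0)
  succDigit = digitGraph b (λ a c → suc a ≡ c)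

  carry-edge : ∀ K u w → E (incPath b K ⊗ carryDigit) u w ⇔ Carry K u w
  carry-edge K u w = mk⇔
    (λ { (x , _ , y , _ , refl , refl , e , (_ , _ , refl , refl , _ , _ , refl , refl)) → x , y , e , refl , refl })
    (λ { (x , y , e , refl , refl) →
           x , [ m ] , y , [ 0 ] , refl , refl , e , (m , 0 , refl , refl , ≤-refl , z<s , refl , refl) })

  incrementLast-edge : ∀ K u w → E (diagonal b K ⊗ succDigit) u w ⇔ IncrementLast K u w
  incrementLast-edge K u w = mk⇔
    (λ { (x , _ , _ , _ , refl , refl , (refl , tx) , (r , _ , refl , refl , _ , 1+r<b , refl)) →
           x , r , tx , s≤s⁻¹ 1+r<b , refl , refl })
    (λ { (x , r , tx , r<m , refl , refl) →
           x , [ r ] , x , [ suc r ] , refl , refl , (refl , tx)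
             , (r , suc r , refl , refl , m<n⇒m<1+n r<m , s≤s r<m , refl) })

  incPath-suc : ∀ K → ((incPath b K ⊗ carryDigit) ∪ (diagonal b K ⊗ succDigit)) ≅ incPath b (suc K)
  incPath-suc K = onTuples-≅ onTuples (λ _ → ⇔-refl) λ u w →
    ⇔-trans (carry-edge K u w ⊎-⇔ incrementLast-edge K u w) (mk⇔ (incPath-suc-edge⁺ K) (incPath-suc-edge⁻ K))
    where
    carrying = incPath b K ⊗ carryDigit
    incrementing = diagonal b K ⊗ succDigit
    onTuples : OnTuples b (suc K) (carrying ∪ incrementing)
    onTuples = subst (λ n → OnTuples b n (carrying ∪ incrementing)) (+-comm K 1)
      (∪-onTuples {G = carrying} {incrementing}
        (⊗-onTuples {G = incPath b K} {carryDigit} (λ _ → ⇔-refl) (λ _ → ⇔-refl))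
        (⊗-onTuples {G = diagonal b K} {succDigit} (λ _ → ⇔-refl) (λ _ → ⇔-refl)))

  succDigit≅incPath : succDigit ≅ incPath b 1
  succDigit≅incPath = onTuples-≅ (λ _ → ⇔-refl) (λ _ → ⇔-refl) λ u w → mk⇔
    (λ { (a , _ , refl , refl , a<b , 1+a<b , refl) →
           a , subst (suc a <_) (sym (*-identityʳ b)) 1+a<b
             , cong [_] (sym (m<n⇒m%n≡m a<b)) , cong [_] (sym (m<n⇒m%n≡m 1+a<b)) })
    (λ { (j , 1+j<b¹ , refl , refl) →
           let 1+j<b = subst (suc j <_) (*-identityʳ b) 1+j<b¹
           in j % b , suc j % b , refl , refl , m%n<n j b , m%n<n (suc j) b
              , trans (cong suc (m<n⇒m%n≡m (<-trans (n<1+n j) 1+j<b))) (sym (m<n⇒m%n≡m 1+j<b)) })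

  succ? : ∀ a c → Dec (suc a ≡ c)
  succ? a c = suc a ≟ c

  carry? : ∀ a c → Dec (a ≡ m × c ≡ 0)
  carry? a c = a ≟ m ×-dec c ≟ 0

  diagonalInput succInput carryInput : InputGraph
  diagonalInput = digitInput b _≟_
  succInput = digitInput b succ?
  carryInput = digitInput b carry?

  -- Each further diagonal factor is unioned with itself only to pad the leaf count,
  -- so that pathF k has exactly (k + 1)² leaves.
  diagF : ℕ → Formula
  diagF zero = leaf diagonalInput
  diagF (suc k) = tensor (union (leaf diagonalInput) (leaf diagonalInput)) (diagF k)

  pathF : ℕ → Formula
  pathF zero = leaf succInput
  pathF (suc k) = union (tensor (pathF k) (leaf carryInput)) (tensor (diagF k) (leaf succInput))

  ⟦diagF⟧ : ∀ k → ⟦ diagF k ⟧ ≅ diagonal b (suc k)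
  ⟦diagF⟧ zero = ≅-trans (inputGraph-digitInput b _≟_) digitGraph-≡
  ⟦diagF⟧ (suc k) = ≅-trans (⊗-cong (≅-trans ∪-idem (⟦diagF⟧ zero)) (⟦diagF⟧ k)) diagonal-⊗

  ⟦pathF⟧ : ∀ k → ⟦ pathF k ⟧ ≅ incPath b (suc k)
  ⟦pathF⟧ zero = ≅-trans (inputGraph-digitInput b succ?) succDigit≅incPath
  ⟦pathF⟧ (suc k) = ≅-trans
    (∪-cong (⊗-cong (⟦pathF⟧ k) (inputGraph-digitInput b carry?))
            (⊗-cong (⟦diagF⟧ k) (inputGraph-digitInput b succ?)))
    (incPath-suc (suc k))

  leaves-diagF : ∀ k → leaves (diagF k) ≡ 1 + 2 * k
  leaves-diagF zero = refl
  leaves-diagF (suc k) = begin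
    2 + leaves (diagF k) ≡⟨ cong (2 +_) (leaves-diagF k) ⟩
    2 + (1 + 2 * k)      ≡⟨ solve 1 (λ k → con 2 :+ (con 1 :+ con 2 :* k) := con 1 :+ con 2 :* (con 1 :+ k)) refl k ⟩
    1 + 2 * suc k        ∎
    where open ≡-Reasoning

  leaves-pathF : ∀ k → leaves (pathF k) ≡ suc k ^ 2
  leaves-pathF zero = refl
  leaves-pathF (suc k) = begin
    leaves (pathF k) + 1 + (leaves (diagF k) + 1) ≡⟨ cong₂ (λ p d → p + 1 + (d + 1)) (leaves-pathF k) (leaves-diagF k) ⟩
    suc k ^ 2 + 1 + (1 + 2 * k + 1)                ≡⟨ solve 1 (λ k → (con 1 :+ k) :^ 2 :+ con 1 :+ (con 1 :+ con 2 :* k :+ con 1)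
                                                                := (con 2 :+ k) :^ 2) refl k ⟩
    suc (suc k) ^ 2                                ∎
    where open ≡-Reasoning

  diagF-inputs : ∀ k → AllInputsAtMost b (diagF k)
  diagF-inputs zero = size-digitInput b _≟_
  diagF-inputs (suc k) = (size-digitInput b _≟_ , size-digitInput b _≟_) , diagF-inputs k

  pathF-inputs : ∀ k → AllInputsAtMost b (pathF k)
  pathF-inputs zero = size-digitInput b succ?
  pathF-inputs (suc k) = (pathF-inputs k , size-digitInput b carry?) , (diagF-inputs k , size-digitInput b succ?)

lemma3p12 : (k b : ℕ) → 1 ≤ k → 2 ≤ b →
    ∃[ f ] (HasComplexity b (k ^ 2) f × ⟦ f ⟧ ≅ incPath b k)
lemma3p12 zero _ () _
lemma3p12 (suc _) zero _ ()
lemma3p12 (suc k) (suc m) _ _ = pathF k , (leaves-pathF k , pathF-inputs k) , ⟦pathF⟧ k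
  where open Base m
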